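{- Let $a,b \in \mathbb{Z}_+$ and let $\mathcal{P}=(\mathcal{H},M,B)$ be a position of the $(a,b)$-game. If a pairing $\Pi$ is complete in $\mathcal{P}$ and $b-|B| \geq \min\left(a,\,|\Pi \cap 2^{V(\mathcal{P})}|\right)$, then Breaker has a winning strategy in the $(a,b)$-game played from the position $\mathcal{P}$ with Maker playing first.
   Context: A hypergraph $\mathcal{H}$ consists of a finite vertex set $V(\mathcal{H})$ and a set $E(\mathcal{H})$ of subsets of $V(\mathcal{H})$ (edges). For $a,b$ (nonnegative integers or $\ast$ = unlimited), the $(a,b)$-game on $\mathcal{H}$: Maker has $a$ tokens and Breaker has $b$ tokens. Players alternate turns, Maker first. On a turn a player may pass, or place one of their own tokens on an unoccupied vertex, the token being either not yet used or moved from its current vertex on the board (which becomes unoccupied). Maker wins as soon as all vertices of some edge carry Maker tokens; Breaker wins if this never happens or if the game reaches the same state twice. A position of the $(a,b)$-game is a triple $(\mathcal{H},M,B)$ with $M,B \subseteq V(\mathcal{H})$, $M\cap B=\varnothing$, $|M|\le a$, $|B|\le b$, where $M$ (resp. $B$) is the set of vertices currently carrying Maker (resp. Breaker) tokens; playing from this position, each player still has their remaining tokens unused. Define $V(\mathcal{P})=V(\mathcal{H})\setminus(M\cup B)$ and $E(\mathcal{P})=\{e\setminus M \mid e\in E(\mathcal{H}),\ e\cap B=\varnothing\}$. A pairing is a set of pairwise disjoint $2$-element sets of vertices. A pairing $\Pi$ is complete in $\mathcal{P}$ if every $e\in E(\mathcal{P})$ contains some pair $\pi\in\Pi$ (i.e.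 $\pi \subseteq e$). $2^{V(\mathcal{P})}$ denotes the power set of $V(\mathcal{P})$. -}

module Defs where

open import Data.Nat using (ℕ; _≤_; _<_; _∸_; _⊓_)
open import Data.Fin using (Fin)
open import Data.Fin.Subset using (Subset; _∈_; _∉_; _∪_; _∩_; _─_; ⁅_⁆; ∣_∣; Empty; _⊆_; ∁)
open import Data.Fin.Subset.Properties using (_⊆?_)
open import Data.List using (List; []; _∷_; length; filter)
import Data.List.Membership.Propositional as L
open import Data.List.Relation.Unary.AllPairs using (AllPairs)
open import Data.Product using (Σ; ∃; _×_; _,_)
open import Data.Sum using (_⊎_)
open import Relation.Binary.PropositionalEquality using (_≡_)
open import Relation.Nullary using (¬_)

-- Vertex set V(H) = Fin n; a hypergraph on Fin n is its list of edges
-- (each edge a subset of Fin n).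
Hypergraph : ℕ → Set
Hypergraph n = List (Subset n)

module _ {n : ℕ} where

  record IsPosition (a b : ℕ) (M B : Subset n) : Set where
    field
      disjoint : Empty (M ∩ B)
      M-bound  : ∣ M ∣ ≤ a
      B-bound  : ∣ B ∣ ≤ b

  VP : Subset n → Subset n → Subset n
  VP M B = ∁ (M ∪ B)

  InEP : Hypergraph n → Subset n → Subset n → Subset n → Set
  InEP E M B f = Σ (Subset n) λ e → (e L.∈ E) × Empty (e ∩ B) × (f ≡ e ─ M)

  -- a pairing: a set of pairwise disjoint 2-element subsets
  -- (pairwise disjointness of list entries also rules out repeated entries)
  IsPairing : List (Subset n) → Set
  IsPairing Π = ((π : Subset n) → π L.∈ Π → ∣ π ∣ ≡ 2)
              × AllPairs (λ π π' → Empty (π ∩ π')) Π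

  Complete : Hypergraph n → Subset n → Subset n → List (Subset n) → Set
  Complete E M B Π = (f : Subset n) → InEP E M B f →
                     Σ (Subset n) λ π → (π L.∈ Π) × (π ⊆ f)

  pairsInside : Subset n → Subset n → List (Subset n) → ℕ
  pairsInside M B Π = length (filter (λ π → π ⊆? VP M B) Π)

  MakerWon : Hypergraph n → Subset n → Set
  MakerWon E M = Σ (Subset n) λ e → (e L.∈ E) × (e ⊆ M)

  -- One turn of a player with k tokens, whose occupied set is X,
  -- opponent's occupied set Y; result is the new occupied set.
  data Step (k : ℕ) (Y X : Subset n) : Subset n → Set where
    pass  : Step k Y X X
    place : (v : Fin n) → v ∉ X → v ∉ Y → ∣ X ∣ < k →
            Step k Y X (X ∪ ⁅ v ⁆)
    move  : (u v : Fin n) → u ∈ X → v ∉ X → v ∉ Y →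
            Step k Y X ((X ─ ⁅ u ⁆) ∪ ⁅ v ⁆)

  data Player : Set where
    maker breaker : Player

  State : Set
  State = Subset n × Subset n × Player

  -- The history h is the list of all states reached so far (including
  -- the current one). Reaching a state a second time is a Breaker win.
  mutual
    data BWinMaker (E : Hypergraph n) (a b : ℕ) (h : List State)
                   (M B : Subset n) : Set where
      bwm : ((M' : Subset n) → Step a B M M' →
               ¬ MakerWon E M' ×
               (((M' , B , breaker) L.∈ h) ⊎
                BWinBreaker E a b ((M' , B , breaker) ∷ h) M' B)) →
            BWinMaker E a b h M B

    data BWinBreaker (E : Hypergraph n) (a b : ℕ) (h : List State)
                     (M B : Subset n) : Set where
      bwb : (B' : Subset n) → Step b M B B' →
            (((M , B' , maker) L.∈ h) ⊎
             BWinMaker E a b ((M , B' , maker) ∷ h) M B') →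
            BWinBreaker E a b h M B

  BreakerWins : Hypergraph n → ℕ → ℕ → Subset n → Subset n → Set
  BreakerWins E a b M B =
    ¬ MakerWon E M × BWinMaker E a b ((M , B , maker) ∷ []) M B

{-# OPTIONS --safe #-}
-- Breaker follows the pairing strategy on R, the pairs of Π lying inside V(P): whenever Maker
-- enters a pair of R that Breaker has not entered, Breaker takes its other vertex, with an unused
-- token if there is one and otherwise by moving a token out of a pair of R that Maker has left.
-- Such a pair exists: Breaker's tokens beyond B lie in distinct pairs of R, so if all b tokens are
-- down then at least b - |B| pairs of R carry a Breaker token, whereas Maker's at most a tokens
-- meet at most min(a, |R|) <= b - |B| pairs, one of them unanswered, so some pair holding a
-- Breaker token holds no Maker token.  Hence Maker never fills a pair of R, and so never an edge,
-- since every edge not meeting B contains a pair of R.  The state space is finite, so the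
-- repetition rule makes the resulting strategy tree finite.
module Submission where

open import Data.Bool.Properties using () renaming (_≟_ to _≟ᵇ_)
open import Data.Fin using (Fin)
open import Data.Fin.Properties using (any?) renaming (_≟_ to _≟ᶠ_)
open import Data.Fin.Subset
  using (Subset; inside; outside; ∣_∣; _∈_; _∉_; _∪_; _∩_; _─_; _-_; ⁅_⁆; Empty; Nonempty; _⊆_)
open import Data.Fin.Subset.Properties
  using (nonempty?; _∈?_; _⊆?_; Empty-unique; ∣⊥∣≡0; ∣⁅x⁆∣≡1; x∈⁅x⁆; x∈⁅y⁆⇒x≡y; p⊆q⇒∣p∣≤∣q∣;
         x∈p∩q⁺; x∈p∩q⁻; x∈p∪q⁺; x∈p∪q⁻; p⊆p∪q; p─q⊆p; x∈p∧x≢y⇒x∈p-y; x∈p⇒∣p-x∣<∣p∣;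
         x∈∁p⇒x∉p; x∉p⇒x∈∁p)
open import Data.List using (List; []; _∷_; [_]; length; filter; map; _++_; cartesianProduct)
open import Data.List.Properties using (length-filter)
open import Data.List.Membership.Propositional using (find; lose) renaming (_∈_ to _∈ₗ_; _∉_ to _∉ₗ_)
open import Data.List.Membership.Propositional.Properties
  using (∈-++⁺ˡ; ∈-++⁺ʳ; ∈-map⁺; ∈-cartesianProduct⁺; ∈-filter⁺; ∈-filter⁻)
open import Data.List.Relation.Unary.All using (lookup)
open import Data.List.Relation.Unary.AllPairs using (AllPairs; []; _∷_)
import Data.List.Relation.Unary.AllPairs.Properties as AllPairs
open import Data.List.Relation.Unary.Any using (here; there)
import Data.List.Relation.Unary.Any as Any
open import Data.Nat using (ℕ; zero; suc; _+_; _∸_; _⊓_; _≤_; _<_; z≤n; s≤s)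
open import Data.Nat.Induction using (<-wellFounded)
open import Data.Nat.Properties
  using (module ≤-Reasoning; ≤-trans; <-trans; ≤-reflexive; <-irrefl; _<?_; ≮⇒≥; >⇒≢; <⇒≱;
         m≤n⇒m≤1+n; n≤1+n; m≤m+n; +-suc; +-comm; +-monoʳ-≤; ⊓-glb; m≤n+o⇒m∸n≤o)
open import Data.Product using (∃; _×_; _,_; proj₁; proj₂)
import Data.Product.Properties as Product
open import Data.Sum using (_⊎_; inj₁; inj₂)
open import Data.Vec using ([]; _∷_; here; there)
import Data.Vec.Properties as Vec
open import Defs
open import Function using (_∘_; _∘₂_; case_of_)
open import Induction.WellFounded using (Acc; acc)
open import Level using (Level)
open import Relation.Binary.Definitions using (DecidableEquality)
open import Relation.Binary.PropositionalEquality using (_≡_; _≢_; refl; sym; trans; cong)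
open import Relation.Nullary using (¬_; yes; no; contradiction; ¬?; _×-dec_)
open import Relation.Unary using (Pred; Decidable)

module _ {ℓ p q : Level} {A : Set ℓ} {P : Pred A p} {Q : Pred A q}
         (P? : Decidable P) (Q? : Decidable Q) where

  length-filter-mono : ∀ xs → (∀ {x} → x ∈ₗ xs → P x → Q x) →
                       length (filter P? xs) ≤ length (filter Q? xs)
  length-filter-mono []       _   = z≤n
  length-filter-mono (x ∷ xs) P⇒Q with P? x | Q? x | length-filter-mono xs (P⇒Q ∘ there)
  ... | yes _  | yes _  | ih = s≤s ih
  ... | yes px | no ¬qx | _  = contradiction (P⇒Q (here refl) px) ¬qx
  ... | no _   | yes _  | ih = m≤n⇒m≤1+n ih
  ... | no _   | no _   | ih = ih

  length-filter-mono-< : ∀ {xs c} → (∀ {x} → x ∈ₗ xs → P x → Q x) → c ∈ₗ xs → Q c → ¬ P c →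
                         length (filter P? xs) < length (filter Q? xs)
  length-filter-mono-< {x ∷ xs} P⇒Q (here refl) qc ¬pc with P? x | Q? x
  ... | yes pc | _      = contradiction pc ¬pc
  ... | no _   | no ¬qc = contradiction qc ¬qc
  ... | no _   | yes _  = s≤s (length-filter-mono xs (P⇒Q ∘ there))
  length-filter-mono-< {x ∷ xs} P⇒Q (there c∈xs) qc ¬pc
    with P? x | Q? x | length-filter-mono-< (P⇒Q ∘ there) c∈xs qc ¬pc
  ... | yes _  | yes _  | ih = s≤s ih
  ... | yes px | no ¬qx | _  = contradiction (P⇒Q (here refl) px) ¬qx
  ... | no _   | yes _  | ih = m≤n⇒m≤1+n ih
  ... | no _   | no _   | ih = ih

private
  variable
    n : ℕ

∣p∪q∣≤∣p∣+∣q∣ : (p q : Subset n) → ∣ p ∪ q ∣ ≤ ∣ p ∣ + ∣ q ∣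
∣p∪q∣≤∣p∣+∣q∣ []            []            = z≤n
∣p∪q∣≤∣p∣+∣q∣ (outside ∷ p) (outside ∷ q) = ∣p∪q∣≤∣p∣+∣q∣ p q
∣p∪q∣≤∣p∣+∣q∣ (inside  ∷ p) (outside ∷ q) = s≤s (∣p∪q∣≤∣p∣+∣q∣ p q)
∣p∪q∣≤∣p∣+∣q∣ (outside ∷ p) (inside  ∷ q) =
  ≤-trans (s≤s (∣p∪q∣≤∣p∣+∣q∣ p q)) (≤-reflexive (sym (+-suc ∣ p ∣ ∣ q ∣)))
∣p∪q∣≤∣p∣+∣q∣ (inside  ∷ p) (inside  ∷ q) =
  s≤s (≤-trans (∣p∪q∣≤∣p∣+∣q∣ p q) (+-monoʳ-≤ ∣ p ∣ (n≤1+n ∣ q ∣)))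

∣p∪⁅x⁆∣≤1+∣p∣ : (p : Subset n) (x : Fin n) → ∣ p ∪ ⁅ x ⁆ ∣ ≤ suc ∣ p ∣
∣p∪⁅x⁆∣≤1+∣p∣ p x = ≤-trans (∣p∪q∣≤∣p∣+∣q∣ p ⁅ x ⁆)
  (≤-reflexive (trans (cong (∣ p ∣ +_) (∣⁅x⁆∣≡1 x)) (+-comm ∣ p ∣ 1)))

∣p-x∪⁅y⁆∣≤∣p∣ : (p : Subset n) {x : Fin n} (y : Fin n) → x ∈ p → ∣ (p - x) ∪ ⁅ y ⁆ ∣ ≤ ∣ p ∣
∣p-x∪⁅y⁆∣≤∣p∣ p {x} y x∈p = ≤-trans (∣p∪⁅x⁆∣≤1+∣p∣ (p - x) y) (x∈p⇒∣p-x∣<∣p∣ x∈p)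

0<∣p∣⇒Nonempty : {p : Subset n} → 0 < ∣ p ∣ → Nonempty p
0<∣p∣⇒Nonempty {n} {p} 0<∣p∣ with nonempty? p
... | yes ne = ne
... | no ¬ne = contradiction (trans (cong ∣_∣ (Empty-unique ¬ne)) (∣⊥∣≡0 n)) (>⇒≢ 0<∣p∣)

1<∣p∣⇒∃≢ : {p : Subset n} → 1 < ∣ p ∣ → (x : Fin n) → ∃ λ y → y ∈ p × y ≢ x
1<∣p∣⇒∃≢ {p = p} 1<∣p∣ x with any? (λ y → (y ∈? p) ×-dec ¬? (y ≟ᶠ x))
... | yes found = found
... | no none   = contradiction (≤-trans (p⊆q⇒∣p∣≤∣q∣ p⊆⁅x⁆) (≤-reflexive (∣⁅x⁆∣≡1 x))) (<⇒≱ 1<∣p∣)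
  where
  p⊆⁅x⁆ : p ⊆ ⁅ x ⁆
  p⊆⁅x⁆ {y} y∈p with y ≟ᶠ x
  ... | yes refl = x∈⁅x⁆ x
  ... | no y≢x   = contradiction (y , y∈p , y≢x) none

x∈p─q⇒x∉q : (p q : Subset n) {x : Fin n} → x ∈ p ─ q → x ∉ q
x∈p─q⇒x∉q (_ ∷ p) (inside ∷ q) () here
x∈p─q⇒x∉q (_ ∷ p) (_      ∷ q) (there x∈p─q) (there x∈q) = x∈p─q⇒x∉q p q x∈p─q x∈q

Disjoint : Subset n → Subset n → Set
Disjoint p q = Empty (p ∩ q)

Meets : Subset n → Subset n → Set
Meets p q = Nonempty (p ∩ q)

meets : {p q : Subset n} {x : Fin n} → x ∈ p → x ∈ q → Meets p q
meets x∈p x∈q = _ , x∈p∩q⁺ (x∈p , x∈q)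

meets-⊆ : {p q r : Subset n} → q ⊆ r → Meets p q → Meets p r
meets-⊆ {p = p} {q} q⊆r (x , x∈p∩q) = meets (proj₁ (x∈p∩q⁻ p q x∈p∩q)) (q⊆r (proj₂ (x∈p∩q⁻ p q x∈p∩q)))

hits : Subset n → List (Subset n) → ℕ
hits S R = length (filter (λ π → nonempty? (π ∩ S)) R)

common-element⇒≡ : {R : List (Subset n)} {π σ : Subset n} {x : Fin n} → AllPairs Disjoint R →
                   π ∈ₗ R → σ ∈ₗ R → x ∈ π → x ∈ σ → π ≡ σ
common-element⇒≡ (_ ∷ _)     (here refl)  (here refl)  _   _   = refl
common-element⇒≡ (ρ#R ∷ _)   (here refl)  (there σ∈R)  x∈π x∈σ = contradiction (meets x∈π x∈σ) (lookup ρ#R σ∈R)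
common-element⇒≡ (ρ#R ∷ _)   (there π∈R)  (here refl)  x∈π x∈σ = contradiction (meets x∈σ x∈π) (lookup ρ#R π∈R)
common-element⇒≡ (_   ∷ R#)  (there π∈R)  (there σ∈R)  x∈π x∈σ = common-element⇒≡ R# π∈R σ∈R x∈π x∈σ

meets-remove-disjoint : {ρ σ S : Subset n} {x : Fin n} → Disjoint ρ σ → x ∈ ρ → Meets σ S → Meets σ (S - x)
meets-remove-disjoint {σ = σ} {S} {x} ρ#σ x∈ρ (y , y∈σ∩S) with y ≟ᶠ x | x∈p∩q⁻ σ S y∈σ∩S
... | yes refl | y∈σ , _   = contradiction (meets x∈ρ y∈σ) ρ#σ
... | no y≢x   | y∈σ , y∈S = meets y∈σ (x∈p∧x≢y⇒x∈p-y y∈S y≢x)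

hits≤∣S∣ : {R : List (Subset n)} → AllPairs Disjoint R → (S : Subset n) → hits S R ≤ ∣ S ∣
hits≤∣S∣ [] S = z≤n
hits≤∣S∣ {R = ρ ∷ R} (ρ#R ∷ R#) S with nonempty? (ρ ∩ S)
... | no _ = hits≤∣S∣ R# S
... | yes (z , z∈ρ∩S) = begin-strict
  hits S R       ≤⟨ length-filter-mono _ _ R (λ σ∈R → meets-remove-disjoint (lookup ρ#R σ∈R) z∈ρ) ⟩
  hits (S - z) R ≤⟨ hits≤∣S∣ R# (S - z) ⟩
  ∣ S - z ∣      <⟨ x∈p⇒∣p-x∣<∣p∣ z∈S ⟩
  ∣ S ∣          ∎
  where
  open ≤-Reasoning
  z∈ρ = proj₁ (x∈p∩q⁻ ρ S z∈ρ∩S)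
  z∈S = proj₂ (x∈p∩q⁻ ρ S z∈ρ∩S)

hits≤1+hits-remove : {R : List (Subset n)} → AllPairs Disjoint R → (S : Subset n) (x : Fin n) →
                     hits S R ≤ suc (hits (S - x) R)
hits≤1+hits-remove [] S x = z≤n
hits≤1+hits-remove {R = ρ ∷ R} (ρ#R ∷ R#) S x
  with nonempty? (ρ ∩ S) | nonempty? (ρ ∩ (S - x)) | hits≤1+hits-remove R# S x
... | yes _ | yes _ | ih = s≤s ih
... | no _  | yes _ | ih = m≤n⇒m≤1+n ih
... | no _  | no _  | ih = ih
... | yes (z , z∈ρ∩S) | no ρ#S-x | _ =
  s≤s (length-filter-mono _ _ R (λ σ∈R → meets-remove-disjoint (lookup ρ#R σ∈R) x∈ρ))
  where
  x∈ρ : x ∈ ρ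
  x∈ρ with z ≟ᶠ x | x∈p∩q⁻ ρ S z∈ρ∩S
  ... | yes refl | z∈ρ , _   = z∈ρ
  ... | no z≢x   | z∈ρ , z∈S = contradiction (meets z∈ρ (x∈p∧x≢y⇒x∈p-y z∈S z≢x)) ρ#S-x

subsets : (n : ℕ) → List (Subset n)
subsets zero    = [ [] ]
subsets (suc n) = map (inside ∷_) (subsets n) ++ map (outside ∷_) (subsets n)

∈-subsets : (p : Subset n) → p ∈ₗ subsets n
∈-subsets []            = here refl
∈-subsets (inside  ∷ p) = ∈-++⁺ˡ (∈-map⁺ (inside ∷_) (∈-subsets p))
∈-subsets (outside ∷ p) = ∈-++⁺ʳ (map (inside ∷_) (subsets _)) (∈-map⁺ (outside ∷_) (∈-subsets p))

module _ {n : ℕ} where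

  _≟ᴾ_ : DecidableEquality (Player {n})
  maker   ≟ᴾ maker   = yes refl
  maker   ≟ᴾ breaker = no λ ()
  breaker ≟ᴾ maker   = no λ ()
  breaker ≟ᴾ breaker = yes refl

  _≟ˢ_ : DecidableEquality (State {n})
  _≟ˢ_ = Product.≡-dec (Vec.≡-dec _≟ᵇ_) (Product.≡-dec (Vec.≡-dec _≟ᵇ_) _≟ᴾ_)

  open import Data.List.Membership.DecPropositional _≟ˢ_ using () renaming (_∈?_ to _∈ₗ?_; _∉?_ to _∉ₗ?_)

  states : List (State {n})
  states = cartesianProduct (subsets n) (cartesianProduct (subsets n) (maker ∷ breaker ∷ []))

  ∈-states : (s : State {n}) → s ∈ₗ states
  ∈-states (M , B , p) = ∈-cartesianProduct⁺ (∈-subsets M) (∈-cartesianProduct⁺ (∈-subsets B) (∈-players p))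
    where
    ∈-players : (p : Player {n}) → p ∈ₗ maker ∷ breaker ∷ []
    ∈-players maker   = here refl
    ∈-players breaker = there (here refl)

  unvisited : List (State {n}) → ℕ
  unvisited h = length (filter (_∉ₗ? h) states)

  unvisited-∷ : {s : State {n}} {h : List (State {n})} → s ∉ₗ h → unvisited (s ∷ h) < unvisited h
  unvisited-∷ {s} s∉h = length-filter-mono-< (_∉ₗ? _) (_∉ₗ? _) (λ _ t∉s∷h t∈h → t∉s∷h (there t∈h))
    (∈-states s) s∉h (λ s∉s∷h → s∉s∷h (here refl))

  module ByInvariant (E : Hypergraph n) (a b : ℕ) (Inv : Subset n → Subset n → Set)
    (Inv⇒¬won : ∀ {M B} → Inv M B → ¬ MakerWon E M)
    (reply : ∀ {M B M'} → Inv M B → Step a B M M' → ∃ λ B' → Step b M' B B' × Inv M' B')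
    where

    makerToMove : ∀ h {M B} → Acc _<_ (unvisited h) → Inv M B → BWinMaker E a b h M B
    makerToMove h {M} {B} (acc rec) inv = bwm answer
      where
      answer : ∀ M' → Step a B M M' →
               ¬ MakerWon E M' ×
               ((M' , B , breaker) ∈ₗ h ⊎ BWinBreaker E a b ((M' , B , breaker) ∷ h) M' B)
      answer M' step with reply inv step | (M' , B , breaker) ∈ₗ? h
      ... | _ , _ , inv' | yes seen = Inv⇒¬won inv' , inj₁ seen
      ... | B' , step' , inv' | no new
        with (M' , B' , maker) ∈ₗ? ((M' , B , breaker) ∷ h)
      ...   | yes seen' = Inv⇒¬won inv' , inj₂ (bwb B' step' (inj₁ seen'))
      ...   | no new'   = Inv⇒¬won inv' , inj₂ (bwb B' step' (inj₂
                            (makerToMove _ (rec (<-trans (unvisited-∷ new') (unvisited-∷ new))) inv')))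

    breakerWins : ∀ {M B} → Inv M B → BreakerWins E a b M B
    breakerWins inv = Inv⇒¬won inv , makerToMove _ (<-wellFounded _) inv

module PairingStrategy {n : ℕ} (a b : ℕ) (E : Hypergraph n) (B₀ : Subset n) (R : List (Subset n))
  (R-large     : ∀ {π} → π ∈ₗ R → 2 ≤ ∣ π ∣)
  (R-disjoint  : AllPairs Disjoint R)
  (R-avoids-B₀ : ∀ {π x} → π ∈ₗ R → x ∈ π → x ∉ B₀)
  (R-covers    : ∀ {e} → e ∈ₗ E → Disjoint e B₀ → ∃ λ π → π ∈ₗ R × π ⊆ e)
  (budget      : a ⊓ length R ≤ b ∸ ∣ B₀ ∣)
  where

  record Invariant (M B : Subset n) : Set where
    field
      B₀⊆B     : B₀ ⊆ B
      disjoint : Disjoint M B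
      M-bound  : ∣ M ∣ ≤ a
      B-bound  : ∣ B ∣ ≤ b
      blocked  : ∀ {π y} → π ∈ₗ R → y ∈ π → y ∈ M → Meets π B
      spent    : ∣ B ∣ ≤ ∣ B₀ ∣ + hits B R

  open Invariant

  initial : {M₀ : Subset n} → IsPosition a b M₀ B₀ → (∀ {π x} → π ∈ₗ R → x ∈ π → x ∉ M₀) →
            Invariant M₀ B₀
  initial pos R-avoids-M₀ = record
    { B₀⊆B     = λ x∈B₀ → x∈B₀
    ; disjoint = IsPosition.disjoint pos
    ; M-bound  = IsPosition.M-bound pos
    ; B-bound  = IsPosition.B-bound pos
    ; blocked  = λ π∈R y∈π y∈M₀ → contradiction y∈M₀ (R-avoids-M₀ π∈R y∈π)
    ; spent    = m≤m+n ∣ B₀ ∣ _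
    }

  Invariant⇒¬won : ∀ {M B} → Invariant M B → ¬ MakerWon E M
  Invariant⇒¬won {M} {B} inv (e , e∈E , e⊆M) with nonempty? (e ∩ B₀)
  ... | yes (x , x∈e∩B₀) =
    disjoint inv (meets (e⊆M (proj₁ (x∈p∩q⁻ e B₀ x∈e∩B₀))) (B₀⊆B inv (proj₂ (x∈p∩q⁻ e B₀ x∈e∩B₀))))
  ... | no e#B₀ with R-covers e∈E e#B₀
  ...   | π , π∈R , π⊆e with 0<∣p∣⇒Nonempty (≤-trans (s≤s z≤n) (R-large π∈R))
  ...     | y , y∈π with blocked inv π∈R y∈π (e⊆M (π⊆e y∈π))
  ...       | z , z∈π∩B =
    disjoint inv (meets (e⊆M (π⊆e (proj₁ (x∈p∩q⁻ π B z∈π∩B)))) (proj₂ (x∈p∩q⁻ π B z∈π∩B)))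

  idlePair : ∀ {M B π} → ∣ M ∣ ≤ a → b ≤ ∣ B ∣ → ∣ B ∣ ≤ ∣ B₀ ∣ + hits B R →
             π ∈ₗ R → Meets π M → ¬ Meets π B → ∃ λ ρ → ρ ∈ₗ R × Meets ρ B × ¬ Meets ρ M
  idlePair {M} {B} {π} ∣M∣≤a b≤∣B∣ B-spent π∈R π∩M π#B
    with Any.any? (λ ρ → nonempty? (ρ ∩ B) ×-dec ¬? (nonempty? (ρ ∩ M))) R
  ... | yes found = find found
  ... | no none = contradiction hits-B<hits-B (<-irrefl refl)
    where
    busy⇒entered : ∀ {ρ} → ρ ∈ₗ R → Meets ρ B → Meets ρ M
    busy⇒entered {ρ} ρ∈R ρ∩B with nonempty? (ρ ∩ M)
    ... | yes ρ∩M = ρ∩M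
    ... | no ρ#M  = contradiction (lose ρ∈R (ρ∩B , ρ#M)) none
    open ≤-Reasoning
    hits-B<hits-B : hits B R < hits B R
    hits-B<hits-B = begin-strict
      hits B R     <⟨ length-filter-mono-< _ _ busy⇒entered π∈R π∩M π#B ⟩
      hits M R     ≤⟨ ⊓-glb (≤-trans (hits≤∣S∣ R-disjoint M) ∣M∣≤a) (length-filter _ R) ⟩
      a ⊓ length R ≤⟨ budget ⟩
      b ∸ ∣ B₀ ∣   ≤⟨ m≤n+o⇒m∸n≤o b ∣ B₀ ∣ (≤-trans b≤∣B∣ B-spent) ⟩
      hits B R     ∎

  module AfterMakerMove {M B : Subset n} (inv : Invariant M B) (X : Subset n) (v : Fin n)
    (X⊆M : X ⊆ M) (v∉B : v ∉ B) (M'-bound : ∣ X ∪ ⁅ v ⁆ ∣ ≤ a) where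

    M' : Subset n
    M' = X ∪ ⁅ v ⁆

    Reply : Set
    Reply = ∃ λ B' → Step b M' B B' × Invariant M' B'

    v∈M' : v ∈ M'
    v∈M' = x∈p∪q⁺ (inj₂ (x∈⁅x⁆ v))

    ∈M'⇒∈M⊎≡v : ∀ {y} → y ∈ M' → y ∈ M ⊎ y ≡ v
    ∈M'⇒∈M⊎≡v y∈M' with x∈p∪q⁻ X ⁅ v ⁆ y∈M'
    ... | inj₁ y∈X   = inj₁ (X⊆M y∈X)
    ... | inj₂ y∈⁅v⁆ = inj₂ (x∈⁅y⁆⇒x≡y v y∈⁅v⁆)

    M'#B : Disjoint M' B
    M'#B (y , y∈M'∩B) with x∈p∩q⁻ M' B y∈M'∩B
    ... | y∈M' , y∈B with ∈M'⇒∈M⊎≡v y∈M'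
    ...   | inj₁ y∈M = disjoint inv (meets y∈M y∈B)
    ...   | inj₂ refl = v∉B y∈B

    stay : (∀ {π} → π ∈ₗ R → v ∈ π → Meets π B) → Reply
    stay v-blocked = B , pass , record
      { B₀⊆B     = B₀⊆B inv
      ; disjoint = M'#B
      ; M-bound  = M'-bound
      ; B-bound  = B-bound inv
      ; blocked  = blocked'
      ; spent    = spent inv
      }
      where
      blocked' : ∀ {π y} → π ∈ₗ R → y ∈ π → y ∈ M' → Meets π B
      blocked' π∈R y∈π y∈M' with ∈M'⇒∈M⊎≡v y∈M'
      ... | inj₁ y∈M = blocked inv π∈R y∈π y∈M
      ... | inj₂ refl = v-blocked π∈R y∈π

    module Threat {π : Subset n} (π∈R : π ∈ₗ R) (v∈π : v ∈ π) (π#B : ¬ Meets π B) where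

      partner : ∃ λ w → w ∈ π × w ≢ v
      partner = 1<∣p∣⇒∃≢ (R-large π∈R) v

      w : Fin n
      w = proj₁ partner

      w∈π : w ∈ π
      w∈π = proj₁ (proj₂ partner)

      w∉B : w ∉ B
      w∉B w∈B = π#B (meets w∈π w∈B)

      w∉M' : w ∉ M'
      w∉M' w∈M' with ∈M'⇒∈M⊎≡v w∈M'
      ... | inj₁ w∈M = π#B (blocked inv π∈R w∈π w∈M)
      ... | inj₂ w≡v = proj₂ (proj₂ partner) w≡v

      w∈Y∪⁅w⁆ : ∀ {Y} → w ∈ Y ∪ ⁅ w ⁆
      w∈Y∪⁅w⁆ = x∈p∪q⁺ (inj₂ (x∈⁅x⁆ w))

      hits-∪⁅w⁆ : ∀ {Y} → ¬ Meets π Y → hits Y R < hits (Y ∪ ⁅ w ⁆) R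
      hits-∪⁅w⁆ π#Y =
        length-filter-mono-< _ _ (λ _ → meets-⊆ (p⊆p∪q ⁅ w ⁆)) π∈R (meets w∈π w∈Y∪⁅w⁆) π#Y

      occupy : ∀ {Y} → Y ⊆ B → B₀ ⊆ Y → ∣ Y ∪ ⁅ w ⁆ ∣ ≤ b →
               ∣ Y ∪ ⁅ w ⁆ ∣ ≤ ∣ B₀ ∣ + hits (Y ∪ ⁅ w ⁆) R →
               (∀ {σ y} → σ ∈ₗ R → y ∈ σ → y ∈ X → Meets σ Y) → Invariant M' (Y ∪ ⁅ w ⁆)
      occupy {Y} Y⊆B B₀⊆Y B'-bound B'-spent X-blocked = record
        { B₀⊆B     = λ x∈B₀ → x∈p∪q⁺ (inj₁ (B₀⊆Y x∈B₀))
        ; disjoint = M'#B'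
        ; M-bound  = M'-bound
        ; B-bound  = B'-bound
        ; blocked  = blocked'
        ; spent    = B'-spent
        }
        where
        M'#B' : Disjoint M' (Y ∪ ⁅ w ⁆)
        M'#B' (y , y∈M'∩B') with x∈p∩q⁻ M' (Y ∪ ⁅ w ⁆) y∈M'∩B'
        ... | y∈M' , y∈B' with x∈p∪q⁻ Y ⁅ w ⁆ y∈B'
        ...   | inj₁ y∈Y   = M'#B (meets y∈M' (Y⊆B y∈Y))
        ...   | inj₂ y∈⁅w⁆ with x∈⁅y⁆⇒x≡y w y∈⁅w⁆
        ...     | refl = w∉M' y∈M'
        blocked' : ∀ {σ y} → σ ∈ₗ R → y ∈ σ → y ∈ M' → Meets σ (Y ∪ ⁅ w ⁆)
        blocked' σ∈R y∈σ y∈M' with x∈p∪q⁻ X ⁅ v ⁆ y∈M'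
        ... | inj₁ y∈X   = meets-⊆ (p⊆p∪q ⁅ w ⁆) (X-blocked σ∈R y∈σ y∈X)
        ... | inj₂ y∈⁅v⁆ with x∈⁅y⁆⇒x≡y v y∈⁅v⁆
        ...   | refl with common-element⇒≡ R-disjoint σ∈R π∈R y∈σ v∈π
        ...     | refl = meets w∈π w∈Y∪⁅w⁆

      claim : ∣ B ∣ < b → Reply
      claim ∣B∣<b = B ∪ ⁅ w ⁆ , place w w∉B w∉M' ∣B∣<b ,
        occupy (λ y∈B → y∈B) (B₀⊆B inv) (≤-trans (∣p∪⁅x⁆∣≤1+∣p∣ B w) ∣B∣<b) B'-spent
               (λ σ∈R y∈σ y∈X → blocked inv σ∈R y∈σ (X⊆M y∈X))
        where
        open ≤-Reasoning
        B'-spent : ∣ B ∪ ⁅ w ⁆ ∣ ≤ ∣ B₀ ∣ + hits (B ∪ ⁅ w ⁆) R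
        B'-spent = begin
          ∣ B ∪ ⁅ w ⁆ ∣              ≤⟨ ∣p∪⁅x⁆∣≤1+∣p∣ B w ⟩
          suc ∣ B ∣                  ≤⟨ s≤s (spent inv) ⟩
          suc (∣ B₀ ∣ + hits B R)    ≡⟨ +-suc ∣ B₀ ∣ (hits B R) ⟨
          ∣ B₀ ∣ + suc (hits B R)    ≤⟨ +-monoʳ-≤ ∣ B₀ ∣ (hits-∪⁅w⁆ π#B) ⟩
          ∣ B₀ ∣ + hits (B ∪ ⁅ w ⁆) R ∎

      relocate : ∀ {ρ x} → ρ ∈ₗ R → x ∈ ρ → x ∈ B → ¬ Meets ρ M' → Reply
      relocate {ρ} {x} ρ∈R x∈ρ x∈B ρ#M' = (B - x) ∪ ⁅ w ⁆ , move x w x∈B w∉B w∉M' ,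
        occupy (p─q⊆p B ⁅ x ⁆) B₀⊆B-x (≤-trans B'≤B (B-bound inv)) B'-spent X-blocked
        where
        B₀⊆B-x : B₀ ⊆ B - x
        B₀⊆B-x y∈B₀ = x∈p∧x≢y⇒x∈p-y (B₀⊆B inv y∈B₀) λ { refl → R-avoids-B₀ ρ∈R x∈ρ y∈B₀ }
        B'≤B : ∣ (B - x) ∪ ⁅ w ⁆ ∣ ≤ ∣ B ∣
        B'≤B = ∣p-x∪⁅y⁆∣≤∣p∣ B w x∈B
        open ≤-Reasoning
        B'-spent : ∣ (B - x) ∪ ⁅ w ⁆ ∣ ≤ ∣ B₀ ∣ + hits ((B - x) ∪ ⁅ w ⁆) R
        B'-spent = begin
          ∣ (B - x) ∪ ⁅ w ⁆ ∣             ≤⟨ B'≤B ⟩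
          ∣ B ∣                           ≤⟨ spent inv ⟩
          ∣ B₀ ∣ + hits B R               ≤⟨ +-monoʳ-≤ ∣ B₀ ∣ (hits≤1+hits-remove R-disjoint B x) ⟩
          ∣ B₀ ∣ + suc (hits (B - x) R)   ≤⟨ +-monoʳ-≤ ∣ B₀ ∣ (hits-∪⁅w⁆ π#B-x) ⟩
          ∣ B₀ ∣ + hits ((B - x) ∪ ⁅ w ⁆) R ∎
          where π#B-x = π#B ∘ meets-⊆ (p─q⊆p B ⁅ x ⁆)
        X-blocked : ∀ {σ y} → σ ∈ₗ R → y ∈ σ → y ∈ X → Meets σ (B - x)
        X-blocked {σ} σ∈R y∈σ y∈X with blocked inv σ∈R y∈σ (X⊆M y∈X)
        ... | z , z∈σ∩B with x∈p∩q⁻ σ B z∈σ∩B | z ≟ᶠ x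
        ...   | z∈σ , z∈B | no z≢x = meets z∈σ (x∈p∧x≢y⇒x∈p-y z∈B z≢x)
        ...   | z∈σ , _   | yes refl with common-element⇒≡ R-disjoint σ∈R ρ∈R z∈σ x∈ρ
        ...     | refl = contradiction (meets y∈σ (x∈p∪q⁺ (inj₁ y∈X))) ρ#M'

      block : Reply
      block with ∣ B ∣ <? b
      ... | yes ∣B∣<b = claim ∣B∣<b
      ... | no ∣B∣≮b with idlePair M'-bound (≮⇒≥ ∣B∣≮b) (spent inv) π∈R (meets v∈π v∈M') π#B
      ...   | ρ , ρ∈R , (x , x∈ρ∩B) , ρ#M' =
        relocate ρ∈R (proj₁ (x∈p∩q⁻ ρ B x∈ρ∩B)) (proj₂ (x∈p∩q⁻ ρ B x∈ρ∩B)) ρ#M'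

    respond : Reply
    respond with Any.any? (λ π → (v ∈? π) ×-dec ¬? (nonempty? (π ∩ B))) R
    ... | yes threatened = let π , π∈R , v∈π , π#B = find threatened in Threat.block π∈R v∈π π#B
    ... | no safe = stay v-blocked
      where
      v-blocked : ∀ {π} → π ∈ₗ R → v ∈ π → Meets π B
      v-blocked {π} π∈R v∈π with nonempty? (π ∩ B)
      ... | yes π∩B = π∩B
      ... | no π#B  = contradiction (lose π∈R (v∈π , π#B)) safe

  reply : ∀ {M B M'} → Invariant M B → Step a B M M' → ∃ λ B' → Step b M' B B' × Invariant M' B'
  reply inv pass = _ , pass , inv
  reply {M} inv (place v _ v∉B ∣M∣<a) =
    AfterMakerMove.respond inv M v (λ y∈M → y∈M) v∉B (≤-trans (∣p∪⁅x⁆∣≤1+∣p∣ M v) ∣M∣<a)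
  reply {M} inv (move u v u∈M _ v∉B) =
    AfterMakerMove.respond inv (M - u) v (p─q⊆p M ⁅ u ⁆) v∉B
      (≤-trans (∣p-x∪⁅y⁆∣≤∣p∣ M v u∈M) (M-bound inv))

insidePairs : Subset n → Subset n → List (Subset n) → List (Subset n)
insidePairs M B Π = filter (_⊆? VP M B) Π

module _ {M B : Subset n} {Π : List (Subset n)} where

  insidePairs-avoid : ∀ {π x} → π ∈ₗ insidePairs M B Π → x ∈ π → x ∉ M × x ∉ B
  insidePairs-avoid π∈R x∈π =
    let x∉M∪B = x∈∁p⇒x∉p (proj₂ (∈-filter⁻ (_⊆? VP M B) {xs = Π} π∈R) x∈π)
    in x∉M∪B ∘ x∈p∪q⁺ ∘ inj₁ , x∉M∪B ∘ x∈p∪q⁺ ∘ inj₂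

  insidePairs-cover : ∀ {E} → Complete E M B Π → ∀ {e} → e ∈ₗ E → Disjoint e B →
                      ∃ λ π → π ∈ₗ insidePairs M B Π × π ⊆ e
  insidePairs-cover complete {e} e∈E e#B with complete (e ─ M) (e , e∈E , e#B , refl)
  ... | π , π∈Π , π⊆e─M = π , ∈-filter⁺ (_⊆? VP M B) π∈Π π⊆VP , p─q⊆p e M ∘ π⊆e─M
    where
    π⊆VP : π ⊆ VP M B
    π⊆VP x∈π = x∉p⇒x∈∁p λ x∈M∪B → case x∈p∪q⁻ M B x∈M∪B of λ where
      (inj₁ x∈M) → x∈p─q⇒x∉q e M (π⊆e─M x∈π) x∈M
      (inj₂ x∈B) → e#B (meets (p─q⊆p e M (π⊆e─M x∈π)) x∈B)

-- The strategy does not need a and b to be positive.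
proposition2p3 : (n a b : ℕ) → 1 ≤ a → 1 ≤ b →
    (E : Hypergraph n) (M B : Subset n) → IsPosition a b M B →
    (Π : List (Subset n)) → IsPairing Π → Complete E M B Π →
    a ⊓ pairsInside M B Π ≤ b ∸ ∣ B ∣ →
    BreakerWins E a b M B
proposition2p3 n a b _ _ E M B position Π (pairs , pairs-disjoint) complete budget =
  breakerWins (initial position (proj₁ ∘₂ R-avoids))
  where
  R : List (Subset n)
  R = insidePairs M B Π
  R-avoids : ∀ {π x} → π ∈ₗ R → x ∈ π → x ∉ M × x ∉ B
  R-avoids = insidePairs-avoid {Π = Π}
  R-pairs : ∀ {π} → π ∈ₗ R → 2 ≤ ∣ π ∣
  R-pairs π∈R = ≤-reflexive (sym (pairs _ (proj₁ (∈-filter⁻ (_⊆? VP M B) {xs = Π} π∈R))))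
  open PairingStrategy a b E B R R-pairs (AllPairs.filter⁺ (_⊆? VP M B) pairs-disjoint)
    (proj₂ ∘₂ R-avoids) (insidePairs-cover {Π = Π} complete) budget
  open ByInvariant E a b Invariant Invariant⇒¬won reply
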